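{- If $G$ and $H$ are connected graphs, then $$s(G)\,s(H)\le \mathrm{gp}_{\rm d}(G\boxtimes H)\le \min\{\,s(G)n(H)+s(H)n(G)-s(G)s(H),\ n(G)\,\mathrm{gp}_{\rm d}(H),\ n(H)\,\mathrm{gp}_{\rm d}(G)\,\}.$$
   Context: All graphs are finite and simple; $n(G)$ is the order of $G$. For $X\subseteq V(G)$, two vertices $u,v$ are $X$-positionable if no shortest $u,v$-path has an internal vertex in $X$. $X$ is a dual general position set if every two vertices of $X$ are $X$-positionable and every two vertices of $V(G)\setminus X$ are $X$-positionable; $\mathrm{gp}_{\rm d}(G)$ is the maximum cardinality of such a set. A vertex is simplicial if its neighbourhood induces a complete subgraph; $s(G)$ is the number of simplicial vertices. The strong product $G\boxtimes H$ has vertex set $V(G)\times V(H)$, with $(g,h)$ and $(g',h')$ adjacent iff either $g=g'$ and $hh'\in E(H)$, or $gg'\in E(G)$ and $h=h'$, or $gg'\in E(G)$ and $hh'\in E(H)$. -}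

module Defs where

open import Data.Nat using (ℕ; zero; suc; _≤_)
open import Data.Bool using (Bool; true; false; _∧_; _∨_)
open import Data.Bool.Properties using () renaming (_≟_ to _≟ᵇ_)
open import Data.Fin using (Fin; remQuot; _≟_)
open import Data.Fin.Properties using (all?)
open import Data.Fin.Subset using (Subset; _∈_; _∉_; ∣_∣)
open import Data.Vec using (tabulate)
open import Data.List using (List; []; _∷_)
open import Data.List.Membership.Propositional using () renaming (_∈_ to _∈ₗ_)
open import Data.Product using (∃; _×_; _,_)
open import Relation.Binary.PropositionalEquality using (_≡_; _≢_)
open import Relation.Nullary using (Dec; ¬_; ¬?; does)
open import Relation.Nullary.Decidable using (⌊_⌋; _→-dec_)

record RawGraph : Set where
  field
    n   : ℕ
    adj : Fin n → Fin n → Bool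
open RawGraph public

record Graph : Set where
  field
    raw    : RawGraph
    symm   : ∀ u v → adj raw u v ≡ adj raw v u
    irrefl : ∀ u → adj raw u u ≡ false
open Graph public

ord : Graph → ℕ
ord G = n (raw G)

module _ (G : RawGraph) where
  data Walk : Fin (n G) → Fin (n G) → ℕ → Set where
    []  : ∀ {u} → Walk u u 0
    _∷_ : ∀ {u w v k} → adj G u w ≡ true → Walk w v k → Walk u v (suc k)

  interior : ∀ {u v k} → Walk u v k → List (Fin (n G))
  interior [] = []
  interior (e ∷ []) = []
  interior (_∷_ {w = w} e (e' ∷ p)) = w ∷ interior (e' ∷ p)

  -- a shortest u,v-path: a walk of minimum length (such walks are paths)
  IsShortest : ∀ {u v k} → Walk u v k → Set
  IsShortest {u} {v} {k} _ = ∀ k' → Walk u v k' → k ≤ k'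

  Connected : Set
  Connected = ∀ u v → ∃ λ k → Walk u v k

  Positionable : Subset (n G) → Fin (n G) → Fin (n G) → Set
  Positionable X u v = ∀ k (p : Walk u v k) → IsShortest p →
                       ∀ x → x ∈ₗ interior p → x ∉ X

  IsDualGP : Subset (n G) → Set
  IsDualGP X = (∀ u v → u ∈ X → v ∈ X → Positionable X u v)
             × (∀ u v → u ∉ X → v ∉ X → Positionable X u v)

  IsGpd : ℕ → Set
  IsGpd m = (∃ λ X → IsDualGP X × ∣ X ∣ ≡ m) × (∀ X → IsDualGP X → ∣ X ∣ ≤ m)

  Simplicial : Fin (n G) → Set
  Simplicial v = ∀ x y → adj G v x ≡ true → adj G v y ≡ true → x ≢ y → adj G x y ≡ true

  simplicial? : ∀ v → Dec (Simplicial v)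
  simplicial? v = all? λ x → all? λ y →
    (adj G v x ≟ᵇ true) →-dec ((adj G v y ≟ᵇ true) →-dec (¬? (x ≟ y) →-dec (adj G x y ≟ᵇ true)))

  s : ℕ
  s = ∣ tabulate (λ v → does (simplicial? v)) ∣

-- strong product; vertex i of Fin (n(G) * n(H)) encodes the pair remQuot i
_⊠_ : RawGraph → RawGraph → RawGraph
G ⊠ H = record
  { n   = n G Data.Nat.* n H
  ; adj = λ i j → go (remQuot (n H) i) (remQuot (n H) j)
  }
  where
  go : Fin (n G) × Fin (n H) → Fin (n G) × Fin (n H) → Bool
  go (g , h) (g' , h') =
       (⌊ g ≟ g' ⌋ ∧ adj H h h')
     ∨ (adj G g g' ∧ ⌊ h ≟ h' ⌋)
     ∨ (adj G g g' ∧ adj H h h')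

-- The simplicial vertices of a graph never lie inside a geodesic, and a vertex of G ⊠ H
-- whose two coordinates are simplicial is simplicial; so the s(G) s(H) such vertices form
-- a dual general position set. Conversely, if both coordinates of (g, h) are non-simplicial,
-- choosing induced paths g₁ g g₂ and h₁ h h₂ makes (g, h) the middle of a geodesic between
-- any two of (g₁, h₁), (g₂, h₁), (g₂, h₂); two of these lie on the same side of a dual
-- general position set X, so (g, h) ∉ X. Hence X lies in the union of the rows and columns
-- through simplicial vertices. Finally every layer {g} × H is a retract of G ⊠ H, hence
-- isometric, so X meets it in a dual general position set of H.
module Submission where

open import Defs
open import Data.Bool using (Bool; true; false; _∧_; _∨_)
open import Data.Bool.Properties using (∧-identityʳ) renaming (_≟_ to _≟ᵇ_)
open import Data.Empty using (⊥; ⊥-elim)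
open import Data.Fin using (Fin; zero; suc; remQuot; combine; _↑ˡ_; _↑ʳ_; _≟_)
open import Data.Fin.Properties
  using (remQuot-combine; combine-remQuot; combine-injectiveˡ; combine-injectiveʳ; ¬∀⟶∃¬; all?)
open import Data.Fin.Subset using (Subset; _∈_; _∉_; ∣_∣; _⊆_)
open import Data.Fin.Subset.Properties using (p⊆q⇒∣p∣≤∣q∣; _∈?_)
open import Data.List.Membership.Propositional using () renaming (_∈_ to _∈ₗ_)
open import Data.List.Relation.Unary.Any using (here; there)
open import Data.Nat using (ℕ; zero; suc; _≤_; _+_; _*_; _∸_; z≤n; s≤s)
open import Data.Nat.Properties hiding (_≟_)
open import Data.Product using (∃; ∃₂; _×_; _,_; proj₁; proj₂; uncurry)
open import Data.Sum using (_⊎_; inj₁; inj₂; [_,_])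
open import Data.Vec using (tabulate; lookup)
open import Data.Vec.Properties using (lookup∘tabulate; tabulate∘lookup; []=⇒lookup; lookup⇒[]=)
open import Function using (_∘_)
open import Relation.Binary.PropositionalEquality hiding ([_])
open import Relation.Nullary using (Dec; yes; no; ¬_; does; ¬?; contradiction)
open import Relation.Nullary.Decidable using (⌊_⌋; _→-dec_)
open import Algebra.Properties.Semiring.Sum +-*-semiring

boolToℕ : Bool → ℕ
boolToℕ true  = 1
boolToℕ false = 0

count : ∀ {m} → (Fin m → Bool) → ℕ
count f = sum (boolToℕ ∘ f)

∣tabulate∣≡count : ∀ {m} (f : Fin m → Bool) → ∣ tabulate f ∣ ≡ count f
∣tabulate∣≡count {zero}  f = refl
∣tabulate∣≡count {suc m} f with f zero
... | true  = cong suc (∣tabulate∣≡count (f ∘ suc))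
... | false = ∣tabulate∣≡count (f ∘ suc)

∣p∣≡count : ∀ {m} (p : Subset m) → ∣ p ∣ ≡ count (lookup p)
∣p∣≡count p = trans (cong ∣_∣ (sym (tabulate∘lookup p))) (∣tabulate∣≡count (lookup p))

∈-tabulate⁺ : ∀ {m} {f : Fin m → Bool} {i} → f i ≡ true → i ∈ tabulate f
∈-tabulate⁺ {f = f} {i} fi = lookup⇒[]= i (tabulate f) (trans (lookup∘tabulate f i) fi)

∈-tabulate⁻ : ∀ {m} {f : Fin m → Bool} {i} → i ∈ tabulate f → f i ≡ true
∈-tabulate⁻ {f = f} {i} i∈ = trans (sym (lookup∘tabulate f i)) ([]=⇒lookup i∈)

sum-mono-≤ : ∀ {m} {f g : Fin m → ℕ} → (∀ i → f i ≤ g i) → sum f ≤ sum g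
sum-mono-≤ {zero}  f≤g = z≤n
sum-mono-≤ {suc m} f≤g = +-mono-≤ (f≤g zero) (sum-mono-≤ (f≤g ∘ suc))

sum-const : ∀ m c → ∑[ i < m ] c ≡ m * c
sum-const zero    c = refl
sum-const (suc m) c = cong (c +_) (sum-const m c)

sum-↑ : ∀ a b (f : Fin (a + b) → ℕ) → sum f ≡ sum (f ∘ (_↑ˡ b)) + sum (f ∘ (a ↑ʳ_))
sum-↑ zero    b f = refl
sum-↑ (suc a) b f = trans (cong (f zero +_) (sum-↑ a b (f ∘ suc))) (sym (+-assoc (f zero) _ _))

sum-combine : ∀ m k (f : Fin (m * k) → ℕ) → sum f ≡ ∑[ g < m ] ∑[ h < k ] f (combine g h)
sum-combine zero    k f = refl
sum-combine (suc m) k f =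
  trans (sum-↑ k (m * k) f) (cong (sum (f ∘ (_↑ˡ m * k)) +_) (sum-combine m k (f ∘ (k ↑ʳ_))))

count-true : ∀ m → count {m} (λ _ → true) ≡ m
count-true m = trans (sum-const m 1) (*-identityʳ m)

count-∧ˡ : ∀ {m} x (f : Fin m → Bool) → count (λ i → x ∧ f i) ≡ boolToℕ x * count f
count-∧ˡ     true  f = sym (+-identityʳ _)
count-∧ˡ {m} false f = trans (sum-const m 0) (*-zeroʳ m)

count-∨+count-∧ : ∀ {m} (f g : Fin m → Bool) →
  count (λ i → f i ∨ g i) + count (λ i → f i ∧ g i) ≡ count f + count g
count-∨+count-∧ f g = begin
  count (λ i → f i ∨ g i) + count (λ i → f i ∧ g i)
    ≡⟨ ∑-distrib-+ (boolToℕ ∘ (λ i → f i ∨ g i)) (boolToℕ ∘ (λ i → f i ∧ g i)) ⟨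
  ∑[ i < _ ] (boolToℕ (f i ∨ g i) + boolToℕ (f i ∧ g i))
    ≡⟨ sum-cong-≗ (λ i → pointwise (f i) (g i)) ⟩
  ∑[ i < _ ] (boolToℕ (f i) + boolToℕ (g i))
    ≡⟨ ∑-distrib-+ (boolToℕ ∘ f) (boolToℕ ∘ g) ⟩
  count f + count g ∎
  where
  open ≡-Reasoning
  pointwise : ∀ x y → boolToℕ (x ∨ y) + boolToℕ (x ∧ y) ≡ boolToℕ x + boolToℕ y
  pointwise true  true  = refl
  pointwise true  false = refl
  pointwise false y     = +-identityʳ _

module Coordinates (m k : ℕ) where

  π₁ : Fin (m * k) → Fin m
  π₁ i = proj₁ (remQuot {m} k i)

  π₂ : Fin (m * k) → Fin k
  π₂ i = proj₂ (remQuot {m} k i)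

  π₁-combine : ∀ (g : Fin m) (h : Fin k) → π₁ (combine g h) ≡ g
  π₁-combine g h = cong proj₁ (remQuot-combine g h)

  π₂-combine : ∀ (g : Fin m) (h : Fin k) → π₂ (combine g h) ≡ h
  π₂-combine g h = cong proj₂ (remQuot-combine g h)

  combine-π : ∀ i → combine (π₁ i) (π₂ i) ≡ i
  combine-π = combine-remQuot {m} k

  π-injective : ∀ {i j} → π₁ i ≡ π₁ j → π₂ i ≡ π₂ j → i ≡ j
  π-injective {i} {j} eq₁ eq₂ =
    trans (sym (combine-π i)) (trans (cong₂ combine eq₁ eq₂) (combine-π j))

  count-π₁∧π₂ : (a : Fin m → Bool) (b : Fin k → Bool) →
    count (λ i → a (π₁ i) ∧ b (π₂ i)) ≡ count a * count b
  count-π₁∧π₂ a b = begin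
    count (λ i → a (π₁ i) ∧ b (π₂ i))
      ≡⟨ sum-combine m k _ ⟩
    ∑[ g < m ] ∑[ h < k ] boolToℕ (uncurry (λ g′ h′ → a g′ ∧ b h′) (remQuot k (combine g h)))
      ≡⟨ sum-cong-≗ (λ g → sum-cong-≗ (λ h →
           cong (boolToℕ ∘ uncurry (λ g′ h′ → a g′ ∧ b h′)) (remQuot-combine g h))) ⟩
    ∑[ g < m ] count (λ h → a g ∧ b h)
      ≡⟨ sum-cong-≗ (λ g → count-∧ˡ (a g) b) ⟩
    ∑[ g < m ] (boolToℕ (a g) * count b)
      ≡⟨ *-distribʳ-sum (count b) (boolToℕ ∘ a) ⟨
    count a * count b ∎
    where open ≡-Reasoning

  count-π₁ : (a : Fin m → Bool) → count (a ∘ π₁) ≡ count a * k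
  count-π₁ a = begin
    count (a ∘ π₁)
      ≡⟨ sum-cong-≗ {m * k} (λ i → cong boolToℕ (sym (∧-identityʳ _))) ⟩
    count (λ i → a (π₁ i) ∧ true)    ≡⟨ count-π₁∧π₂ a (λ _ → true) ⟩
    count a * count {k} (λ _ → true) ≡⟨ cong (count a *_) (count-true k) ⟩
    count a * k                      ∎
    where open ≡-Reasoning

  count-π₂ : (b : Fin k → Bool) → count (b ∘ π₂) ≡ m * count b
  count-π₂ b = trans (count-π₁∧π₂ (λ _ → true) b) (cong (_* count b) (count-true m))

Close : (R : RawGraph) → Fin (n R) → Fin (n R) → Set
Close R u v = u ≡ v ⊎ adj R u v ≡ true

Close⇒adj : ∀ {R u v} → Close R u v → u ≢ v → adj R u v ≡ true
Close⇒adj (inj₁ u≡v) u≢v = contradiction u≡v u≢v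
Close⇒adj (inj₂ uv)  _   = uv

adj⇒≢ : (G : Graph) {u v : Fin (ord G)} → adj (raw G) u v ≡ true → u ≢ v
adj⇒≢ G {u} uu refl with trans (sym uu) (irrefl G u)
... | ()

record InducedP₃ (R : RawGraph) (a x b : Fin (n R)) : Set where
  field
    adjˡ : adj R a x ≡ true
    adjʳ : adj R x b ≡ true
    far  : ¬ Close R a b

  walk : Walk R a b 2
  walk = adjˡ ∷ (adjʳ ∷ [])

  walk-shortest : IsShortest R walk
  walk-shortest _ []            = ⊥-elim (far (inj₁ refl))
  walk-shortest _ (ab ∷ [])     = ⊥-elim (far (inj₂ ab))
  walk-shortest _ (_ ∷ (_ ∷ _)) = s≤s (s≤s z≤n)

IsShortest-tail : ∀ {R u w v k} (uw : adj R u w ≡ true) (p : Walk R w v k) →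
  IsShortest R (uw ∷ p) → IsShortest R p
IsShortest-tail uw p shortest k q = ≤-pred (shortest (suc k) (uw ∷ q))

shortest-interior⇒InducedP₃ : ∀ {R u v k} (p : Walk R u v k) → IsShortest R p →
  ∀ {x} → x ∈ₗ interior R p → ∃₂ λ a b → InducedP₃ R a x b
shortest-interior⇒InducedP₃ {R} {u} (uw ∷ (_∷_ {w = w′} ww′ q)) shortest (here refl) =
  u , w′ , record { adjˡ = uw ; adjʳ = ww′ ; far = far }
  where
  far : ¬ Close R u w′
  far (inj₁ refl) = 1+n≰n (≤-trans (n≤1+n _) (shortest _ q))
  far (inj₂ uw′)  = 1+n≰n (shortest _ (uw′ ∷ q))
shortest-interior⇒InducedP₃ (uw ∷ p@(_ ∷ _)) shortest (there x∈) =
  shortest-interior⇒InducedP₃ p (IsShortest-tail uw p shortest) x∈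

module _ {R : RawGraph} {X : Subset (n R)} where

  noInducedP₃Middle⇒DualGP : (∀ {a x b} → InducedP₃ R a x b → x ∉ X) → IsDualGP R X
  noInducedP₃Middle⇒DualGP noMiddle = (λ _ _ _ _ → avoids) , (λ _ _ _ _ → avoids)
    where
    avoids : ∀ {u v} → Positionable R X u v
    avoids k p shortest x x∈ with shortest-interior⇒InducedP₃ p shortest x∈
    ... | _ , _ , P₃ = noMiddle P₃

  DualGP-InducedP₃-splits : IsDualGP R X → ∀ {a x b} → InducedP₃ R a x b → x ∈ X →
    (a ∈ X → b ∈ X → ⊥) × (a ∉ X → b ∉ X → ⊥)
  DualGP-InducedP₃-splits (inside , outside) {x = x} P₃ x∈X =
      (λ a∈ b∈ → inside  _ _ a∈ b∈ 2 walk walk-shortest x (here refl) x∈X)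
    , (λ a∉ b∉ → outside _ _ a∉ b∉ 2 walk walk-shortest x (here refl) x∈X)
    where open InducedP₃ P₃

  DualGP-P₃-triangle : IsDualGP R X → ∀ {u v w x} →
    InducedP₃ R u x v → InducedP₃ R v x w → InducedP₃ R u x w → x ∉ X
  DualGP-P₃-triangle gp {u} {v} {w} uxv vxw uxw x∈X with u ∈? X | v ∈? X | w ∈? X
  ... | yes u∈ | yes v∈ | _      = proj₁ (DualGP-InducedP₃-splits gp uxv x∈X) u∈ v∈
  ... | yes u∈ | no  _  | yes w∈ = proj₁ (DualGP-InducedP₃-splits gp uxw x∈X) u∈ w∈
  ... | yes _  | no  v∉ | no  w∉ = proj₂ (DualGP-InducedP₃-splits gp vxw x∈X) v∉ w∉
  ... | no  u∉ | no  v∉ | _      = proj₂ (DualGP-InducedP₃-splits gp uxv x∈X) u∉ v∉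
  ... | no  _  | yes v∈ | yes w∈ = proj₁ (DualGP-InducedP₃-splits gp vxw x∈X) v∈ w∈
  ... | no  u∉ | yes _  | no  w∉ = proj₂ (DualGP-InducedP₃-splits gp uxw x∈X) u∉ w∉

¬-→ : ∀ {A B : Set} → Dec A → ¬ (A → B) → A × ¬ B
¬-→ (yes a) ¬a→b = a , λ b → ¬a→b (λ _ → b)
¬-→ (no ¬a) ¬a→b = ⊥-elim (¬a→b (λ a → contradiction a ¬a))

does-∧ : ∀ {A B : Set} (a? : Dec A) (b? : Dec B) → does a? ∧ does b? ≡ true → A × B
does-∧ (yes a) (yes b) _ = a , b
does-∧ (yes _) (no _)  ()
does-∧ (no _)  _       ()

does-∨ : ∀ {A B : Set} (a? : Dec A) (b? : Dec B) → (¬ A → ¬ B → ⊥) → does a? ∨ does b? ≡ true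
does-∨ (yes _) _       _     = refl
does-∨ (no _)  (yes _) _     = refl
does-∨ (no ¬a) (no ¬b) ¬¬a∨b = ⊥-elim (¬¬a∨b ¬a ¬b)

module _ (G : Graph) where
  private
    R = raw G

    clique? : ∀ v a b → Dec (adj R v a ≡ true → adj R v b ≡ true → a ≢ b → adj R a b ≡ true)
    clique? v a b =
      (adj R v a ≟ᵇ true) →-dec ((adj R v b ≟ᵇ true) →-dec (¬? (a ≟ b) →-dec (adj R a b ≟ᵇ true)))

  Simplicial-Close-trans : ∀ {a g b} → Simplicial R g → Close R a g → Close R g b → Close R a b
  Simplicial-Close-trans _    (inj₁ refl) gb          = gb
  Simplicial-Close-trans _    (inj₂ ag)   (inj₁ refl) = inj₂ ag
  Simplicial-Close-trans {a} {g} {b} simp (inj₂ ag) (inj₂ gb) with a ≟ b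
  ... | yes a≡b = inj₁ a≡b
  ... | no  a≢b = inj₂ (simp a b (trans (symm G g a) ag) gb a≢b)

  ¬Simplicial⇒InducedP₃ : ∀ {v} → ¬ Simplicial R v → ∃₂ λ a b → InducedP₃ R a v b
  ¬Simplicial⇒InducedP₃ {v} ¬simp
    with a , ¬∀b       ← ¬∀⟶∃¬ _ _ (λ a → all? (clique? v a)) ¬simp
    with b , ¬clique   ← ¬∀⟶∃¬ _ _ (clique? v a) ¬∀b
    with va , ¬clique′ ← ¬-→ (adj R v a ≟ᵇ true) ¬clique
    with vb , ¬clique″ ← ¬-→ (adj R v b ≟ᵇ true) ¬clique′
    with a≢b , ¬ab     ← ¬-→ (¬? (a ≟ b)) ¬clique″
    = a , b , record { adjˡ = trans (symm G a v) va ; adjʳ = vb ; far = [ a≢b , ¬ab ] }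

  simplicial : Fin (ord G) → Bool
  simplicial v = does (simplicial? R v)

  s≡count : s R ≡ count simplicial
  s≡count = ∣tabulate∣≡count simplicial

-- Retracts are isometric

module Retract (A B : RawGraph) (ι : Fin (n B) → Fin (n A)) (π : Fin (n A) → Fin (n B))
  (π∘ι : ∀ x → π (ι x) ≡ x)
  (ι-adj : ∀ {u v} → adj B u v ≡ true → adj A (ι u) (ι v) ≡ true)
  (π-Close : ∀ {u v} → adj A u v ≡ true → Close B (π u) (π v)) where

  map-walk : ∀ {u v k} → Walk B u v k → Walk A (ι u) (ι v) k
  map-walk []      = []
  map-walk (e ∷ p) = ι-adj e ∷ map-walk p

  interior-map-walk : ∀ {u v k} (p : Walk B u v k) {x} →
    x ∈ₗ interior B p → ι x ∈ₗ interior A (map-walk p)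
  interior-map-walk (_ ∷ (_ ∷ _))   (here refl) = here refl
  interior-map-walk (_ ∷ p@(_ ∷ _)) (there x∈)  = there (interior-map-walk p x∈)

  project-walk : ∀ {a b k} → Walk A a b k → ∃ λ k′ → k′ ≤ k × Walk B (π a) (π b) k′
  project-walk [] = 0 , z≤n , []
  project-walk {b = b} (e ∷ p) with project-walk p | π-Close e
  ... | k′ , k′≤ , q | inj₁ eq =
    k′ , m≤n⇒m≤1+n k′≤ , subst (λ z → Walk B z (π b) k′) (sym eq) q
  ... | k′ , k′≤ , q | inj₂ e′ = suc k′ , s≤s k′≤ , e′ ∷ q

  map-walk-shortest : ∀ {u v k} (p : Walk B u v k) → IsShortest B p → IsShortest A (map-walk p)
  map-walk-shortest {u} {v} p shortest _ q with project-walk q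
  ... | k′ , k′≤ , q′ =
    ≤-trans (shortest k′ (subst₂ (λ a b → Walk B a b k′) (π∘ι u) (π∘ι v) q′)) k′≤

  preimage : Subset (n A) → Subset (n B)
  preimage X = tabulate (lookup X ∘ ι)

  preimage-DualGP : ∀ {X} → IsDualGP A X → IsDualGP B (preimage X)
  preimage-DualGP {X} (inside , outside) =
      (λ u v u∈ v∈ → pull (inside  _ _ (∈⁻ u∈) (∈⁻ v∈)))
    , (λ u v u∉ v∉ → pull (outside _ _ (u∉ ∘ ∈⁺) (v∉ ∘ ∈⁺)))
    where
    ∈⁺ : ∀ {x} → ι x ∈ X → x ∈ preimage X
    ∈⁺ ιx∈ = ∈-tabulate⁺ ([]=⇒lookup ιx∈)
    ∈⁻ : ∀ {x} → x ∈ preimage X → ι x ∈ X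
    ∈⁻ x∈ = lookup⇒[]= _ X (∈-tabulate⁻ x∈)
    pull : ∀ {u v} → Positionable A X (ι u) (ι v) → Positionable B (preimage X) u v
    pull pos k p shortest x x∈ x∈X =
      pos k (map-walk p) (map-walk-shortest p shortest) (ι x) (interior-map-walk p x∈) (∈⁻ x∈X)

  count-preimage≤gpd : ∀ {X c} → IsDualGP A X → IsGpd B c → count (lookup X ∘ ι) ≤ c
  count-preimage≤gpd {X} gp (_ , maximal) =
    subst (_≤ _) (∣tabulate∣≡count (lookup X ∘ ι)) (maximal (preimage X) (preimage-DualGP gp))

-- Adjacency in _⊠_ has this shape, with a? and b? the equality tests of the coordinates.
⊠-adjᵇ-sound : ∀ {A B : Set} (a? : Dec A) (b? : Dec B) x y →
  (⌊ a? ⌋ ∧ y) ∨ (x ∧ ⌊ b? ⌋) ∨ (x ∧ y) ≡ true → (A ⊎ x ≡ true) × (B ⊎ y ≡ true)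
⊠-adjᵇ-sound (yes a) (yes b) _     _     _  = inj₁ a , inj₁ b
⊠-adjᵇ-sound (yes a) (no _)  _     true  _  = inj₁ a , inj₂ refl
⊠-adjᵇ-sound (yes _) (no _)  true  false ()
⊠-adjᵇ-sound (yes _) (no _)  false false ()
⊠-adjᵇ-sound (no _)  (yes b) true  _     _  = inj₂ refl , inj₁ b
⊠-adjᵇ-sound (no _)  (yes _) false _     ()
⊠-adjᵇ-sound (no _)  (no _)  true  true  _  = inj₂ refl , inj₂ refl
⊠-adjᵇ-sound (no _)  (no _)  true  false ()
⊠-adjᵇ-sound (no _)  (no _)  false _     ()

⊠-adjᵇ-complete : ∀ {A B : Set} (a? : Dec A) (b? : Dec B) x y →
  (A ⊎ x ≡ true) → (B ⊎ y ≡ true) → ¬ (A × B) →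
  (⌊ a? ⌋ ∧ y) ∨ (x ∧ ⌊ b? ⌋) ∨ (x ∧ y) ≡ true
⊠-adjᵇ-complete (yes a) (yes b) _     _     _        _        ¬ab = ⊥-elim (¬ab (a , b))
⊠-adjᵇ-complete (yes _) (no _)  _     true  _        _        _   = refl
⊠-adjᵇ-complete (yes _) (no ¬b) _     false _        (inj₁ b) _   = ⊥-elim (¬b b)
⊠-adjᵇ-complete (no _)  (yes _) true  _     _        _        _   = refl
⊠-adjᵇ-complete (no ¬a) (yes _) false _     (inj₁ a) _        _   = ⊥-elim (¬a a)
⊠-adjᵇ-complete (no _)  (no _)  true  true  _        _        _   = refl
⊠-adjᵇ-complete (no ¬a) (no _)  false _     (inj₁ a) _        _   = ⊥-elim (¬a a)
⊠-adjᵇ-complete (no _)  (no ¬b) true  false _        (inj₁ b) _   = ⊥-elim (¬b b)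

module StrongProduct (G H : Graph) where
  private
    RG = raw G
    RH = raw H

  P : RawGraph
  P = RG ⊠ RH

  open Coordinates (ord G) (ord H)

  Close-⊠⁻ : ∀ {i j} → Close P i j → Close RG (π₁ i) (π₁ j) × Close RH (π₂ i) (π₂ j)
  Close-⊠⁻ (inj₁ refl)       = inj₁ refl , inj₁ refl
  Close-⊠⁻ {i} {j} (inj₂ ij) = ⊠-adjᵇ-sound (π₁ i ≟ π₁ j) (π₂ i ≟ π₂ j) _ _ ij

  Close-⊠⁺ : ∀ {i j} → Close RG (π₁ i) (π₁ j) → Close RH (π₂ i) (π₂ j) → Close P i j
  Close-⊠⁺ {i} {j} c₁ c₂ with i ≟ j
  ... | yes i≡j = inj₁ i≡j
  ... | no  i≢j =
    inj₂ (⊠-adjᵇ-complete (π₁ i ≟ π₁ j) (π₂ i ≟ π₂ j) _ _ c₁ c₂ (i≢j ∘ uncurry π-injective))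

  Close-⊠-combine⁻ : ∀ {g g′ h h′} →
    Close P (combine g h) (combine g′ h′) → Close RG g g′ × Close RH h h′
  Close-⊠-combine⁻ {g} {g′} {h} {h′} c with Close-⊠⁻ c
  ... | c₁ , c₂ = subst₂ (Close RG) (π₁-combine g h) (π₁-combine g′ h′) c₁
                , subst₂ (Close RH) (π₂-combine g h) (π₂-combine g′ h′) c₂

  Close-⊠-combine⁺ : ∀ {g g′ h h′} →
    Close RG g g′ → Close RH h h′ → Close P (combine g h) (combine g′ h′)
  Close-⊠-combine⁺ {g} {g′} {h} {h′} c₁ c₂ = Close-⊠⁺
    (subst₂ (Close RG) (sym (π₁-combine g h)) (sym (π₁-combine g′ h′)) c₁)
    (subst₂ (Close RH) (sym (π₂-combine g h)) (sym (π₂-combine g′ h′)) c₂)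

  ⊠-InducedP₃ : ∀ {a g b c h d} →
    adj RG a g ≡ true → adj RG g b ≡ true → Close RH c h → Close RH h d →
    ¬ (Close RG a b × Close RH c d) → InducedP₃ P (combine a c) (combine g h) (combine b d)
  ⊠-InducedP₃ {a} {g} {b} {c} {h} {d} ag gb ch hd far = record
    { adjˡ = Close⇒adj {P} (Close-⊠-combine⁺ (inj₂ ag) ch)
                           (adj⇒≢ G ag ∘ combine-injectiveˡ {ord G} {ord H} a c g h)
    ; adjʳ = Close⇒adj {P} (Close-⊠-combine⁺ (inj₂ gb) hd)
                           (adj⇒≢ G gb ∘ combine-injectiveˡ {ord G} {ord H} g h b d)
    ; far  = far ∘ Close-⊠-combine⁻
    }

  simplicial-pair-not-middle : ∀ {a x b} →
    Simplicial RG (π₁ x) → Simplicial RH (π₂ x) → ¬ InducedP₃ P a x b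
  simplicial-pair-not-middle simp₁ simp₂ P₃
    with ax₁ , ax₂ ← Close-⊠⁻ (inj₂ (InducedP₃.adjˡ P₃))
    with xb₁ , xb₂ ← Close-⊠⁻ (inj₂ (InducedP₃.adjʳ P₃))
    = InducedP₃.far P₃ (Close-⊠⁺ (Simplicial-Close-trans G simp₁ ax₁ xb₁)
                                 (Simplicial-Close-trans H simp₂ ax₂ xb₂))

  non-simplicial-pair∉DualGP : ∀ {X g h} →
    IsDualGP P X → ¬ Simplicial RG g → ¬ Simplicial RH h → combine g h ∉ X
  non-simplicial-pair∉DualGP gp ¬simp₁ ¬simp₂
    with _ , _ , g-P₃ ← ¬Simplicial⇒InducedP₃ G ¬simp₁
    with _ , _ , h-P₃ ← ¬Simplicial⇒InducedP₃ H ¬simp₂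
    = DualGP-P₃-triangle gp
        (⊠-InducedP₃ g.adjˡ g.adjʳ (inj₂ h.adjˡ) (inj₂ (trans (symm H _ _) h.adjˡ)) (g.far ∘ proj₁))
        (⊠-InducedP₃ (trans (symm G _ _) g.adjʳ) g.adjʳ (inj₂ h.adjˡ) (inj₂ h.adjʳ) (h.far ∘ proj₂))
        (⊠-InducedP₃ g.adjˡ g.adjʳ (inj₂ h.adjˡ) (inj₂ h.adjʳ) (g.far ∘ proj₁))
    where
    module g = InducedP₃ g-P₃
    module h = InducedP₃ h-P₃

  σ₁ σ₂ : Fin (n P) → Bool
  σ₁ = simplicial G ∘ π₁
  σ₂ = simplicial H ∘ π₂

  SimplicialPairs : Subset (n P)
  SimplicialPairs = tabulate (λ i → σ₁ i ∧ σ₂ i)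

  SimplicialPairs-DualGP : IsDualGP P SimplicialPairs
  SimplicialPairs-DualGP = noInducedP₃Middle⇒DualGP λ {_} {x} P₃ x∈ →
    let simp₁ , simp₂ = does-∧ (simplicial? RG (π₁ x)) (simplicial? RH (π₂ x)) (∈-tabulate⁻ x∈)
    in simplicial-pair-not-middle simp₁ simp₂ P₃

  ∣SimplicialPairs∣ : ∣ SimplicialPairs ∣ ≡ s RG * s RH
  ∣SimplicialPairs∣ = begin
    ∣ SimplicialPairs ∣                         ≡⟨ ∣tabulate∣≡count (λ i → σ₁ i ∧ σ₂ i) ⟩
    count (λ i → σ₁ i ∧ σ₂ i)                   ≡⟨ count-π₁∧π₂ (simplicial G) (simplicial H) ⟩
    count (simplicial G) * count (simplicial H) ≡⟨ cong₂ _*_ (s≡count G) (s≡count H) ⟨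
    s RG * s RH                                 ∎
    where open ≡-Reasoning

  SimplicialCover : Subset (n P)
  SimplicialCover = tabulate (λ i → σ₁ i ∨ σ₂ i)

  DualGP⊆SimplicialCover : ∀ {X} → IsDualGP P X → X ⊆ SimplicialCover
  DualGP⊆SimplicialCover {X} gp {i} i∈X =
    ∈-tabulate⁺ (does-∨ (simplicial? RG (π₁ i)) (simplicial? RH (π₂ i)) λ ¬simp₁ ¬simp₂ →
      non-simplicial-pair∉DualGP gp ¬simp₁ ¬simp₂ (subst (_∈ X) (sym (combine-π i)) i∈X))

  ∣SimplicialCover∣ : ∣ SimplicialCover ∣ ≡ s RG * ord H + s RH * ord G ∸ s RG * s RH
  ∣SimplicialCover∣ = begin
    ∣ SimplicialCover ∣                       ≡⟨ ∣tabulate∣≡count σ∨ ⟩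
    count σ∨                                  ≡⟨ m+n∸n≡m (count σ∨) (count σ∧) ⟨
    count σ∨ + count σ∧ ∸ count σ∧            ≡⟨ cong₂ _∸_ (count-∨+count-∧ σ₁ σ₂) pairs ⟩
    count σ₁ + count σ₂ ∸ s RG * s RH         ≡⟨ cong (_∸ s RG * s RH) (cong₂ _+_ rows columns) ⟩
    s RG * ord H + s RH * ord G ∸ s RG * s RH ∎
    where
    open ≡-Reasoning
    σ∨ σ∧ : Fin (n P) → Bool
    σ∨ i = σ₁ i ∨ σ₂ i
    σ∧ i = σ₁ i ∧ σ₂ i
    pairs : count σ∧ ≡ s RG * s RH
    pairs = trans (sym (∣tabulate∣≡count σ∧)) ∣SimplicialPairs∣
    rows : count σ₁ ≡ s RG * ord H
    rows = trans (count-π₁ (simplicial G)) (cong (_* ord H) (sym (s≡count G)))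
    columns : count σ₂ ≡ s RH * ord G
    columns = trans (count-π₂ (simplicial H))
                    (trans (*-comm (ord G) _) (cong (_* ord G) (sym (s≡count H))))

  module Layerᴴ (g : Fin (ord G)) = Retract P RH (combine g) π₂ (π₂-combine g)
    (λ {u} {v} uv → Close⇒adj {P} (Close-⊠-combine⁺ {g} {g} (inj₁ refl) (inj₂ uv))
                                  (adj⇒≢ H uv ∘ combine-injectiveʳ {ord G} {ord H} g u g v))
    (λ uv → proj₂ (Close-⊠⁻ (inj₂ uv)))

  module Layerᴳ (h : Fin (ord H)) = Retract P RG (λ g → combine g h) π₁ (λ g → π₁-combine g h)
    (λ {u} {v} uv → Close⇒adj {P} (Close-⊠-combine⁺ {h = h} {h} (inj₂ uv) (inj₁ refl))
                                  (adj⇒≢ G uv ∘ combine-injectiveˡ {ord G} {ord H} u h v h))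
    (λ uv → proj₁ (Close-⊠⁻ (inj₂ uv)))

  ∣DualGP∣≤ordG*gpdH : ∀ {X c} → IsDualGP P X → IsGpd RH c → ∣ X ∣ ≤ ord G * c
  ∣DualGP∣≤ordG*gpdH {X} {c} gp gpd = begin
    ∣ X ∣                                               ≡⟨ ∣p∣≡count X ⟩
    count (lookup X)                                    ≡⟨ sum-combine (ord G) (ord H) _ ⟩
    ∑[ g < ord G ] count (λ h → lookup X (combine g h))
      ≤⟨ sum-mono-≤ (λ g → Layerᴴ.count-preimage≤gpd g gp gpd) ⟩
    ∑[ g < ord G ] c                                    ≡⟨ sum-const (ord G) c ⟩
    ord G * c                                           ∎
    where open ≤-Reasoning

  ∣DualGP∣≤ordH*gpdG : ∀ {X b} → IsDualGP P X → IsGpd RG b → ∣ X ∣ ≤ ord H * b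
  ∣DualGP∣≤ordH*gpdG {X} {b} gp gpd = begin
    ∣ X ∣                                               ≡⟨ ∣p∣≡count X ⟩
    count (lookup X)                                    ≡⟨ sum-combine (ord G) (ord H) _ ⟩
    ∑[ g < ord G ] count (λ h → lookup X (combine g h))
      ≡⟨ ∑-comm {ord G} {ord H} (λ g h → boolToℕ (lookup X (combine g h))) ⟩
    ∑[ h < ord H ] count {ord G} (λ g → lookup X (combine g h))
      ≤⟨ sum-mono-≤ (λ h → Layerᴳ.count-preimage≤gpd h gp gpd) ⟩
    ∑[ h < ord H ] b                                    ≡⟨ sum-const (ord H) b ⟩
    ord H * b                                           ∎
    where open ≤-Reasoning

theorem4p6 : (G H : Graph) → Connected (raw G) → Connected (raw H) →
    ∀ a b c → IsGpd (raw G ⊠ raw H) a → IsGpd (raw G) b → IsGpd (raw H) c →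
    (s (raw G) * s (raw H) ≤ a)
    × (a ≤ s (raw G) * ord H + s (raw H) * ord G ∸ s (raw G) * s (raw H))
    × (a ≤ ord G * c)
    × (a ≤ ord H * b)
theorem4p6 G H _ _ a b c ((X , X-gp , ∣X∣≡a) , maximal) gpd-G gpd-H =
    subst (_≤ a) ∣SimplicialPairs∣ (maximal SimplicialPairs SimplicialPairs-DualGP)
  , subst (_≤ _) ∣X∣≡a (begin
      ∣ X ∣               ≤⟨ p⊆q⇒∣p∣≤∣q∣ (DualGP⊆SimplicialCover X-gp) ⟩
      ∣ SimplicialCover ∣ ≡⟨ ∣SimplicialCover∣ ⟩
      _                   ∎)
  , subst (_≤ _) ∣X∣≡a (∣DualGP∣≤ordG*gpdH X-gp gpd-H)
  , subst (_≤ _) ∣X∣≡a (∣DualGP∣≤ordH*gpdG X-gp gpd-G)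
  where
  open StrongProduct G H
  open ≤-Reasoning
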